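{- The product $m^{(-1)}_\square:=\widetilde\tau\circ m^{(-1)}_\ast\circ(\widetilde\tau\otimes\widetilde\tau)\colon \mathfrak{H}^0\otimes \mathfrak{H}^0 \to \mathfrak{H}^0$ coincides with the shuffle product $m^{(-1)}_{\sqcup\!\sqcup}\colon \mathfrak{H}^0\otimes \mathfrak{H}^0 \to \mathfrak{H}^0$.
   Context: Let $\mathfrak{H}:=\mathbb{Q}\langle p,y \rangle$ with unit $\mathbf{1}$; $\mathfrak{H}^1 := \mathbb{Q}\mathbf{1}\oplus \mathbb{Q}\langle p,y \rangle y$, $\mathfrak{H}^{(-1)} := \mathbb{Q}\mathbf{1}\oplus p\mathbb{Q}\langle p,y\rangle$, $\mathfrak{H}^0=\mathfrak{H}^1\cap\mathfrak{H}^{(-1)}$, and $z_k:=p^ky$ ($k\in\mathbb{N}_0$). Let $\widetilde\tau$ be the involutive anti-automorphism of $\mathfrak{H}$ with $\widetilde\tau(p)=y$, $\widetilde\tau(y)=p$; it preserves $\mathfrak{H}^0$. The weight $-1$ quasi-shuffle product $\ast_{ -1}$ (i.e. $m^{(-1)}_\ast$) on $\mathfrak{H}^1$ is given by $\mathbf{1} \ast_{ -1} w := w \ast_{ -1} \mathbf{1}:= w$ and $z_n u \ast_{ -1} z_m v := z_n (u \ast_{ -1} z_m v) + z_m(z_n u \ast_{ -1} v)- z_{n+m}(u\ast_{ -1} v)$ ($n,m\in\mathbb{N}_0$); with deconcatenation coproduct it is a Hopf algebra, with character given by the Schlesinger--Zudilin $q$-multiple zeta star values $\zeta^{\operatorname{SZ},\star}(z_{k_1}\cdots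 z_{k_n}) := \sum_{m_1\geq\cdots \geq m_n>0} \frac{q^{m_1k_1+\cdots +m_nk_n}}{(1-q^{m_1})^{k_1}\cdots (1-q^{m_n})^{k_n}}$. The weight $-1$ shuffle product ${\sqcup\!\sqcup}_{ -1}$ (i.e. $m^{(-1)}_{\sqcup\!\sqcup}$) is given by $\mathbf{1}\,{\sqcup\!\sqcup}_{ -1}\, w := w\,{\sqcup\!\sqcup}_{ -1}\, \mathbf{1}:= w$, $yu \,{\sqcup\!\sqcup}_{ -1}\, v:= u\,{\sqcup\!\sqcup}_{ -1}\, yv:= y(u\,{\sqcup\!\sqcup}_{ -1}\, v)$, $pu \,{\sqcup\!\sqcup}_{ -1}\, pv:=p(u \,{\sqcup\!\sqcup}_{ -1}\, pv) + p(pu \,{\sqcup\!\sqcup}_{ -1}\, v) - p(u\,{\sqcup\!\sqcup}_{ -1}\, v)$; it is the shuffle product satisfied by the Ohno--Okuda--Zudilin $q$-MZVs $\zeta^{\operatorname{OOZ}}(k_1,\ldots,k_n)=\sum_{m_1>\cdots>m_n>0}\frac{q^{m_1}}{(1-q^{m_1})^{k_1}\cdots(1-q^{m_n})^{k_n}}$, and $\zeta^{\operatorname{OOZ}}(w)=\zeta^{\operatorname{SZ},\star}(\widetilde\tau(w))$ for $w\in\mathfrak{H}^0$. -}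

module Defs where

open import Data.Nat using (ℕ; zero; suc)
open import Data.Integer using (ℤ; +_)
open import Data.Rational using (ℚ; 0ℚ; 1ℚ; _+_; _*_; -_)
open import Data.Rational as ℚ using ()
open import Data.List using (List; []; _∷_; _++_; map; reverse; replicate; concatMap; foldr)
open import Data.List.Relation.Unary.All using (All)
open import Data.Product using (_×_; _,_; ∃)
open import Data.Sum using (_⊎_)
open import Relation.Binary.PropositionalEquality using (_≡_; refl)
open import Relation.Nullary using (Dec; yes; no)
open import Relation.Binary using (DecidableEquality)
open import Data.List.Properties using (≡-dec)
open import Data.Bool using (if_then_else_)
open import Relation.Nullary.Decidable using (⌊_⌋)

-- Alphabet {p, y} and words = monomials of 𝔥 = ℚ⟨p,y⟩
data Letter : Set where
  p y : Letter

_≟L_ : DecidableEquality Letter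
p ≟L p = yes refl
p ≟L y = no λ ()
y ≟L p = no λ ()
y ≟L y = yes refl

Word : Set
Word = List Letter

_≟W_ : DecidableEquality Word
_≟W_ = ≡-dec _≟L_

-- Finite ℚ-linear combinations of elements of A (formal sums, not normalised)
Lin : Set → Set
Lin A = List (ℚ × A)

coeff : Lin Word → Word → ℚ
coeff P w = foldr (λ { (c , u) acc → (if ⌊ u ≟W w ⌋ then c else 0ℚ) + acc }) 0ℚ P

_≈_ : Lin Word → Lin Word → Set
P ≈ Q = ∀ w → coeff P w ≡ coeff Q w

scale : {A : Set} → ℚ → Lin A → Lin A
scale c = map (λ { (d , u) → (c * d , u) })

linMap : {A B : Set} → (A → B) → Lin A → Lin B
linMap f = map (λ { (c , u) → (c , f u) })

bilin : {A : Set} → (A → A → Lin A) → Lin A → Lin A → Lin A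
bilin m P Q = concatMap (λ { (c , u) → concatMap (λ { (d , v) → scale (c * d) (m u v) }) Q }) P

InH1 : Word → Set
InH1 w = (w ≡ []) ⊎ ∃ λ u → w ≡ u ++ (y ∷ [])

InHm1 : Word → Set
InHm1 w = (w ≡ []) ⊎ ∃ λ u → w ≡ p ∷ u

InH0 : Word → Set
InH0 w = InH1 w × InHm1 w

InH0Lin : Lin Word → Set
InH0Lin P = All (λ cu → InH0 (Data.Product.proj₂ cu)) P

swap : Letter → Letter
swap p = y
swap y = p

τ : Word → Word
τ w = reverse (map swap w)

τLin : Lin Word → Lin Word
τLin = linMap τ

-- words in z_k = p^k y ; z-words are lists of indices
fromZ : List ℕ → Word
fromZ [] = []
fromZ (k ∷ ks) = replicate k p ++ (y ∷ fromZ ks)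

-- parse a word of 𝔥¹ as a z-word (trailing p's, absent in 𝔥¹, are dropped)
toZ-go : ℕ → Word → List ℕ
toZ-go k [] = []
toZ-go k (p ∷ w) = toZ-go (suc k) w
toZ-go k (y ∷ w) = k ∷ toZ-go 0 w

toZ : Word → List ℕ
toZ = toZ-go 0

qsh : List ℕ → List ℕ → Lin (List ℕ)
qsh [] v = (1ℚ , v) ∷ []
qsh (n ∷ u) [] = (1ℚ , n ∷ u) ∷ []
qsh (n ∷ u) (m ∷ v) =
  linMap (n ∷_) (qsh u (m ∷ v)) ++
  linMap (m ∷_) (qsh (n ∷ u) v) ++
  scale (- 1ℚ) (linMap ((n Data.Nat.+ m) ∷_) (qsh u v))

qshW : Word → Word → Lin Word
qshW u v = linMap fromZ (qsh (toZ u) (toZ v))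

shW : Word → Word → Lin Word
shW [] v = (1ℚ , v) ∷ []
shW (a ∷ u) [] = (1ℚ , a ∷ u) ∷ []
shW (y ∷ u) v = linMap (y ∷_) (shW u v)
shW (p ∷ u) (y ∷ v) = linMap (y ∷_) (shW (p ∷ u) v)
shW (p ∷ u) (p ∷ v) =
  linMap (p ∷_) (shW u (p ∷ v)) ++
  linMap (p ∷_) (shW (p ∷ u) v) ++
  scale (- 1ℚ) (linMap (p ∷_) (shW u v))

boxProd : Lin Word → Lin Word → Lin Word
boxProd P Q = τLin (bilin qshW (τLin P) (τLin Q))

shProd : Lin Word → Lin Word → Lin Word
shProd = bilin shW

{-# OPTIONS --safe #-}
-- Both products are bilinear, and a formal sum is determined by its values under all
-- linear extensions eval φ of functions φ : Word → ℚ, so it suffices to compare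
-- eval φ ∘ τ̃ ∘ m_* ∘ (τ̃ ⊗ τ̃) with eval φ ∘ m_ш on pairs of words of 𝔥⁰.
-- Such a word is τ̃(z_{k₁} ⋯ z_{kᵣ}) = p y^{kᵣ} ⋯ p y^{k₁}: τ̃ turns the last letters of
-- z-words into leading blocks p y^k. The quasi-shuffle obeys its defining recursion on
-- last letters as well, and under τ̃ its three terms for z_n, z_m become the three terms
-- of the shuffle recursion on p y^n ⋯ and p y^m ⋯ (the y's pass through the shuffle
-- unchanged, and z_{n+m} becomes p y^n y^m). Induction along both z-words from the right
-- concludes. Only the 𝔥^(-1) half of membership in 𝔥⁰ is needed.
module Submission where

open import Defs
open import Data.Bool using (Bool; true; false; if_then_else_)
open import Data.List using (List; []; _∷_; _++_; _∷ʳ_; map; reverse; replicate; concatMap)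
open import Data.List.Properties
  using (++-assoc; ++-identityʳ; map-++; map-∘; map-cong; map-id; reverse-++; reverse-map; reverse-involutive)
open import Data.List.Relation.Unary.All using (All; []; _∷_)
open import Data.List.Reverse using (Reverse; []; _∶_∶ʳ_; reverseView)
open import Data.Nat using (ℕ; zero; suc)
import Data.Nat as ℕ
open import Data.Product using (_×_; _,_; proj₂)
open import Data.Rational using (ℚ; 0ℚ; 1ℚ; _+_; _*_; -_)
open import Data.Rational.Properties
  using (+-identityˡ; +-identityʳ; *-identityˡ; *-identityʳ; +-assoc; *-assoc; *-distribˡ-+; *-zeroʳ)
open import Data.Rational.Solver using (module +-*-Solver)
open import Data.Sum using (inj₁; inj₂)
open import Function using (_∘_; id)
open import Relation.Binary.PropositionalEquality
  using (_≡_; _≗_; refl; sym; trans; cong; cong₂; module ≡-Reasoning)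
open import Relation.Nullary.Decidable using (⌊_⌋)

eval : {A : Set} → (A → ℚ) → Lin A → ℚ
eval φ [] = 0ℚ
eval φ ((c , a) ∷ P) = c * φ a + eval φ P

module _ {A : Set} where

  eval-++ : (φ : A → ℚ) (P Q : Lin A) → eval φ (P ++ Q) ≡ eval φ P + eval φ Q
  eval-++ φ [] Q = sym (+-identityˡ _)
  eval-++ φ ((c , a) ∷ P) Q = trans (cong (c * φ a +_) (eval-++ φ P Q)) (sym (+-assoc (c * φ a) _ _))

  eval-scale : (φ : A → ℚ) (c : ℚ) (P : Lin A) → eval φ (scale c P) ≡ c * eval φ P
  eval-scale φ c [] = sym (*-zeroʳ c)
  eval-scale φ c ((d , a) ∷ P) =
    trans (cong₂ _+_ (*-assoc c d (φ a)) (eval-scale φ c P)) (sym (*-distribˡ-+ c _ _))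

  eval-cong : {φ ψ : A → ℚ} → φ ≗ ψ → (P : Lin A) → eval φ P ≡ eval ψ P
  eval-cong φ≗ψ [] = refl
  eval-cong φ≗ψ ((c , a) ∷ P) = cong₂ (λ s t → c * s + t) (φ≗ψ a) (eval-cong φ≗ψ P)

  eval-unit : (φ : A → ℚ) (a : A) → eval φ ((1ℚ , a) ∷ []) ≡ φ a
  eval-unit φ a = trans (+-identityʳ _) (*-identityˡ _)

eval-linMap : {A B : Set} (φ : B → ℚ) (f : A → B) (P : Lin A) →
  eval φ (linMap f P) ≡ eval (φ ∘ f) P
eval-linMap φ f [] = refl
eval-linMap φ f ((c , a) ∷ P) = cong (c * φ (f a) +_) (eval-linMap φ f P)

concatMap-eval-cong : {A B C : Set} (Pr : A → Set) (f : A → A) (φ : B → ℚ) (ψ : C → ℚ)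
  (g : ℚ × A → Lin B) (h : ℚ × A → Lin C) (P : Lin A) → All (Pr ∘ proj₂) P →
  (∀ c {a} → Pr a → eval φ (g (c , f a)) ≡ eval ψ (h (c , a))) →
  eval φ (concatMap g (linMap f P)) ≡ eval ψ (concatMap h P)
concatMap-eval-cong Pr f φ ψ g h [] [] g≈h = refl
concatMap-eval-cong Pr f φ ψ g h ((c , a) ∷ P) (pa ∷ pP) g≈h = begin
  eval φ (g (c , f a) ++ concatMap g (linMap f P))
    ≡⟨ eval-++ φ (g (c , f a)) _ ⟩
  eval φ (g (c , f a)) + eval φ (concatMap g (linMap f P))
    ≡⟨ cong₂ _+_ (g≈h c pa) (concatMap-eval-cong Pr f φ ψ g h P pP g≈h) ⟩
  eval ψ (h (c , a)) + eval ψ (concatMap h P)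
    ≡⟨ sym (eval-++ ψ (h (c , a)) _) ⟩
  eval ψ (h (c , a) ++ concatMap h P) ∎
  where open ≡-Reasoning

bilin-eval-cong : {A : Set} (Pr : A → Set) (f : A → A) (φ ψ : A → ℚ) (m m′ : A → A → Lin A)
  (P Q : Lin A) → All (Pr ∘ proj₂) P → All (Pr ∘ proj₂) Q →
  (∀ {u v} → Pr u → Pr v → eval φ (m (f u) (f v)) ≡ eval ψ (m′ u v)) →
  eval φ (bilin m (linMap f P) (linMap f Q)) ≡ eval ψ (bilin m′ P Q)
bilin-eval-cong Pr f φ ψ m m′ P Q hP hQ m≈m′ =
  concatMap-eval-cong Pr f φ ψ _ _ P hP λ c {u} pu →
    concatMap-eval-cong Pr f φ ψ _ _ Q hQ λ d {v} pv →
      trans (eval-scale φ (c * d) (m (f u) (f v)))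
        (trans (cong ((c * d) *_) (m≈m′ pu pv)) (sym (eval-scale ψ (c * d) (m′ u v))))

indicator : Word → Word → ℚ
indicator w u = if ⌊ u ≟W w ⌋ then 1ℚ else 0ℚ

coeff≡eval-indicator : (P : Lin Word) (w : Word) → coeff P w ≡ eval (indicator w) P
coeff≡eval-indicator [] w = refl
coeff≡eval-indicator ((c , u) ∷ P) w = cong₂ _+_ (select ⌊ u ≟W w ⌋) (coeff≡eval-indicator P w)
  where
  select : (b : Bool) → (if b then c else 0ℚ) ≡ c * (if b then 1ℚ else 0ℚ)
  select true = sym (*-identityʳ c)
  select false = sym (*-zeroʳ c)

eval≡⇒≈ : (P Q : Lin Word) → (∀ φ → eval φ P ≡ eval φ Q) → P ≈ Q
eval≡⇒≈ P Q eq w =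
  trans (coeff≡eval-indicator P w) (trans (eq (indicator w)) (sym (coeff≡eval-indicator Q w)))

infix 5 _⊕_⊖_

-- Opaque, so that reasoning chains with `_ ⊕ _ ⊖ _` placeholders unify componentwise.
opaque
  _⊕_⊖_ : ℚ → ℚ → ℚ → ℚ
  a ⊕ b ⊖ c = a + (b + (- 1ℚ) * c)

⊕⊖-cong : {a a′ b b′ c c′ : ℚ} →
  a ≡ a′ → b ≡ b′ → c ≡ c′ → a ⊕ b ⊖ c ≡ a′ ⊕ b′ ⊖ c′
⊕⊖-cong refl refl refl = refl

opaque
  unfolding _⊕_⊖_
  ⊕⊖-unfold : {a b c : ℚ} → a ⊕ b ⊖ c ≡ a + (b + (- 1ℚ) * c)
  ⊕⊖-unfold = refl

  open +-*-Solver

  private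
    _⊕ᴾ_⊖ᴾ_ : ∀ {n} → Polynomial n → Polynomial n → Polynomial n → Polynomial n
    a ⊕ᴾ b ⊖ᴾ c = a :+ (b :+ con (- 1ℚ) :* c)

  ⊕⊖-swap : (a b c : ℚ) → a ⊕ b ⊖ c ≡ b ⊕ a ⊖ c
  ⊕⊖-swap = solve 3 (λ a b c → a ⊕ᴾ b ⊖ᴾ c := b ⊕ᴾ a ⊖ᴾ c) refl

  ⊕⊖-exchangeˡ : (a b c d e : ℚ) → a ⊕ (b ⊕ d ⊖ e) ⊖ c ≡ b ⊕ (a ⊕ d ⊖ c) ⊖ e
  ⊕⊖-exchangeˡ = solve 5 (λ a b c d e →
    a ⊕ᴾ (b ⊕ᴾ d ⊖ᴾ e) ⊖ᴾ c := b ⊕ᴾ (a ⊕ᴾ d ⊖ᴾ c) ⊖ᴾ e) refl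

  ⊕⊖-exchangeʳ : (a b c d e : ℚ) → (a ⊕ d ⊖ e) ⊕ b ⊖ c ≡ (a ⊕ b ⊖ c) ⊕ d ⊖ e
  ⊕⊖-exchangeʳ = solve 5 (λ a b c d e →
    (a ⊕ᴾ d ⊖ᴾ e) ⊕ᴾ b ⊖ᴾ c := (a ⊕ᴾ b ⊖ᴾ c) ⊕ᴾ d ⊖ᴾ e) refl

  ⊕⊖-interchange : (a₁ a₂ a₃ b₁ b₂ b₃ c₁ c₂ c₃ : ℚ) →
    (a₁ ⊕ a₂ ⊖ a₃) ⊕ (b₁ ⊕ b₂ ⊖ b₃) ⊖ (c₁ ⊕ c₂ ⊖ c₃) ≡
    (a₁ ⊕ b₁ ⊖ c₁) ⊕ (a₂ ⊕ b₂ ⊖ c₂) ⊖ (a₃ ⊕ b₃ ⊖ c₃)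
  ⊕⊖-interchange = solve 9 (λ a₁ a₂ a₃ b₁ b₂ b₃ c₁ c₂ c₃ →
    (a₁ ⊕ᴾ a₂ ⊖ᴾ a₃) ⊕ᴾ (b₁ ⊕ᴾ b₂ ⊖ᴾ b₃) ⊖ᴾ (c₁ ⊕ᴾ c₂ ⊖ᴾ c₃) :=
    (a₁ ⊕ᴾ b₁ ⊖ᴾ c₁) ⊕ᴾ (a₂ ⊕ᴾ b₂ ⊖ᴾ c₂) ⊖ᴾ (a₃ ⊕ᴾ b₃ ⊖ᴾ c₃)) refl

eval-⊕⊖ : {A B : Set} (φ : B → ℚ) (f g h : A → B) (P Q R : Lin A) →
  eval φ (linMap f P ++ linMap g Q ++ scale (- 1ℚ) (linMap h R)) ≡
  eval (φ ∘ f) P ⊕ eval (φ ∘ g) Q ⊖ eval (φ ∘ h) R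
eval-⊕⊖ φ f g h P Q R = begin
  eval φ (linMap f P ++ linMap g Q ++ scale (- 1ℚ) (linMap h R))
    ≡⟨ eval-++ φ (linMap f P) _ ⟩
  eval φ (linMap f P) + eval φ (linMap g Q ++ scale (- 1ℚ) (linMap h R))
    ≡⟨ cong (eval φ (linMap f P) +_) (eval-++ φ (linMap g Q) _) ⟩
  eval φ (linMap f P) + (eval φ (linMap g Q) + eval φ (scale (- 1ℚ) (linMap h R)))
    ≡⟨ cong (λ r → eval φ (linMap f P) + (eval φ (linMap g Q) + r))
            (eval-scale φ (- 1ℚ) (linMap h R)) ⟩
  eval φ (linMap f P) + (eval φ (linMap g Q) + (- 1ℚ) * eval φ (linMap h R))
    ≡⟨ ⊕⊖-unfold ⟨
  eval φ (linMap f P) ⊕ eval φ (linMap g Q) ⊖ eval φ (linMap h R)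
    ≡⟨ ⊕⊖-cong (eval-linMap φ f P) (eval-linMap φ g Q) (eval-linMap φ h R) ⟩
  eval (φ ∘ f) P ⊕ eval (φ ∘ g) Q ⊖ eval (φ ∘ h) R ∎
  where open ≡-Reasoning

eval-qsh-[]ʳ : (φ : List ℕ → ℚ) (u : List ℕ) → eval φ (qsh u []) ≡ φ u
eval-qsh-[]ʳ φ [] = eval-unit φ []
eval-qsh-[]ʳ φ (n ∷ u) = eval-unit φ (n ∷ u)

eval-qsh-∷-∷ : (φ : List ℕ → ℚ) (n : ℕ) (u : List ℕ) (m : ℕ) (v : List ℕ) →
  eval φ (qsh (n ∷ u) (m ∷ v)) ≡
  eval (φ ∘ (n ∷_)) (qsh u (m ∷ v)) ⊕ eval (φ ∘ (m ∷_)) (qsh (n ∷ u) v)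
    ⊖ eval (φ ∘ ((n ℕ.+ m) ∷_)) (qsh u v)
eval-qsh-∷-∷ φ n u m v =
  eval-⊕⊖ φ (n ∷_) (m ∷_) ((n ℕ.+ m) ∷_) (qsh u (m ∷ v)) (qsh (n ∷ u) v) (qsh u v)

eval-qsh-∷ʳ-∷ʳ : (u v : List ℕ) (n m : ℕ) (φ : List ℕ → ℚ) →
  eval φ (qsh (u ∷ʳ n) (v ∷ʳ m)) ≡
  eval (φ ∘ (_∷ʳ n)) (qsh u (v ∷ʳ m)) ⊕ eval (φ ∘ (_∷ʳ m)) (qsh (u ∷ʳ n) v)
    ⊖ eval (φ ∘ (_∷ʳ (n ℕ.+ m))) (qsh u v)
eval-qsh-∷ʳ-∷ʳ [] [] n m φ = trans (eval-qsh-∷-∷ φ n [] m []) (⊕⊖-swap _ _ _)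
eval-qsh-∷ʳ-∷ʳ [] (k ∷ v) n m φ = begin
  eval φ (qsh (n ∷ []) (k ∷ v ∷ʳ m))
    ≡⟨ eval-qsh-∷-∷ φ n [] k (v ∷ʳ m) ⟩
  a ⊕ eval (φ ∘ (k ∷_)) (qsh (n ∷ []) (v ∷ʳ m)) ⊖ c
    ≡⟨ ⊕⊖-cong refl (eval-qsh-∷ʳ-∷ʳ [] v n m (φ ∘ (k ∷_))) refl ⟩
  a ⊕ (b ⊕ d ⊖ e) ⊖ c
    ≡⟨ ⊕⊖-exchangeˡ a b c d e ⟩
  b ⊕ (a ⊕ d ⊖ c) ⊖ e
    ≡⟨ ⊕⊖-cong refl (eval-qsh-∷-∷ (φ ∘ (_∷ʳ m)) n [] k v) refl ⟨
  b ⊕ eval (φ ∘ (_∷ʳ m)) (qsh (n ∷ []) (k ∷ v)) ⊖ e ∎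
  where
  open ≡-Reasoning
  a b c d e : ℚ
  a = eval (φ ∘ (n ∷_)) (qsh [] (k ∷ v ∷ʳ m))
  b = eval (φ ∘ (k ∷_) ∘ (_∷ʳ n)) (qsh [] (v ∷ʳ m))
  c = eval (φ ∘ ((n ℕ.+ k) ∷_)) (qsh [] (v ∷ʳ m))
  d = eval (φ ∘ (k ∷_) ∘ (_∷ʳ m)) (qsh (n ∷ []) v)
  e = eval (φ ∘ (k ∷_) ∘ (_∷ʳ (n ℕ.+ m))) (qsh [] v)
eval-qsh-∷ʳ-∷ʳ (x ∷ u) [] n m φ = begin
  eval φ (qsh (x ∷ u ∷ʳ n) (m ∷ []))
    ≡⟨ eval-qsh-∷-∷ φ x (u ∷ʳ n) m [] ⟩
  eval (φ ∘ (x ∷_)) (qsh (u ∷ʳ n) (m ∷ [])) ⊕ b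
    ⊖ eval (φ ∘ ((x ℕ.+ m) ∷_)) (qsh (u ∷ʳ n) [])
    ≡⟨ ⊕⊖-cong (eval-qsh-∷ʳ-∷ʳ u [] n m (φ ∘ (x ∷_))) refl (eval-qsh-[]ʳ _ (u ∷ʳ n)) ⟩
  (a ⊕ eval (φ ∘ (x ∷_) ∘ (_∷ʳ m)) (qsh (u ∷ʳ n) [])
     ⊖ eval (φ ∘ (x ∷_) ∘ (_∷ʳ (n ℕ.+ m))) (qsh u [])) ⊕ b ⊖ c
    ≡⟨ ⊕⊖-cong (⊕⊖-cong refl (eval-qsh-[]ʳ _ (u ∷ʳ n)) (eval-qsh-[]ʳ _ u)) refl refl ⟩
  (a ⊕ d ⊖ e) ⊕ b ⊖ c
    ≡⟨ ⊕⊖-exchangeʳ a b c d e ⟩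
  (a ⊕ b ⊖ c) ⊕ d ⊖ e
    ≡⟨ ⊕⊖-cong expandˡ (eval-unit (φ ∘ (_∷ʳ m)) (x ∷ u ∷ʳ n))
                       (eval-unit (φ ∘ (_∷ʳ (n ℕ.+ m))) (x ∷ u)) ⟨
  eval (φ ∘ (_∷ʳ n)) (qsh (x ∷ u) (m ∷ [])) ⊕ eval (φ ∘ (_∷ʳ m)) (qsh (x ∷ u ∷ʳ n) [])
    ⊖ eval (φ ∘ (_∷ʳ (n ℕ.+ m))) (qsh (x ∷ u) []) ∎
  where
  open ≡-Reasoning
  a b c d e : ℚ
  a = eval (φ ∘ (x ∷_) ∘ (_∷ʳ n)) (qsh u (m ∷ []))
  b = eval (φ ∘ (m ∷_)) (qsh (x ∷ u ∷ʳ n) [])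
  c = φ ((x ℕ.+ m) ∷ u ∷ʳ n)
  d = φ (x ∷ u ∷ʳ n ∷ʳ m)
  e = φ (x ∷ u ∷ʳ (n ℕ.+ m))
  expandˡ : eval (φ ∘ (_∷ʳ n)) (qsh (x ∷ u) (m ∷ [])) ≡ a ⊕ b ⊖ c
  expandˡ = trans (eval-qsh-∷-∷ (φ ∘ (_∷ʳ n)) x u m []) (⊕⊖-cong refl refl (eval-qsh-[]ʳ _ u))
eval-qsh-∷ʳ-∷ʳ (x ∷ u) (k ∷ v) n m φ = begin
  eval φ (qsh (x ∷ u ∷ʳ n) (k ∷ v ∷ʳ m))
    ≡⟨ eval-qsh-∷-∷ φ x (u ∷ʳ n) k (v ∷ʳ m) ⟩
  _ ⊕ _ ⊖ _
    ≡⟨ ⊕⊖-cong (eval-qsh-∷ʳ-∷ʳ u (k ∷ v) n m (φ ∘ (x ∷_)))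
               (eval-qsh-∷ʳ-∷ʳ (x ∷ u) v n m (φ ∘ (k ∷_)))
               (eval-qsh-∷ʳ-∷ʳ u v n m (φ ∘ ((x ℕ.+ k) ∷_))) ⟩
  (_ ⊕ _ ⊖ _) ⊕ (_ ⊕ _ ⊖ _) ⊖ (_ ⊕ _ ⊖ _)
    ≡⟨ ⊕⊖-interchange _ _ _ _ _ _ _ _ _ ⟩
  (_ ⊕ _ ⊖ _) ⊕ (_ ⊕ _ ⊖ _) ⊖ (_ ⊕ _ ⊖ _)
    ≡⟨ ⊕⊖-cong (eval-qsh-∷-∷ (φ ∘ (_∷ʳ n)) x u k (v ∷ʳ m))
               (eval-qsh-∷-∷ (φ ∘ (_∷ʳ m)) x (u ∷ʳ n) k v)
               (eval-qsh-∷-∷ (φ ∘ (_∷ʳ (n ℕ.+ m))) x u k v) ⟨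
  eval (φ ∘ (_∷ʳ n)) (qsh (x ∷ u) (k ∷ v ∷ʳ m))
    ⊕ eval (φ ∘ (_∷ʳ m)) (qsh (x ∷ u ∷ʳ n) (k ∷ v))
    ⊖ eval (φ ∘ (_∷ʳ (n ℕ.+ m))) (qsh (x ∷ u) (k ∷ v)) ∎
  where open ≡-Reasoning

infix 10 y^_

y^_ : ℕ → Word
y^ n = replicate n y

replicate-suc-++ : {A : Set} (k : ℕ) (a : A) (w : List A) →
  replicate (suc k) a ++ w ≡ replicate k a ++ a ∷ w
replicate-suc-++ zero a w = refl
replicate-suc-++ (suc k) a w = cong (a ∷_) (replicate-suc-++ k a w)

replicate-+-++ : {A : Set} (n m : ℕ) (a : A) (w : List A) →
  replicate n a ++ replicate m a ++ w ≡ replicate (n ℕ.+ m) a ++ w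
replicate-+-++ zero m a w = refl
replicate-+-++ (suc n) m a w = cong (a ∷_) (replicate-+-++ n m a w)

τ-++ : (u v : Word) → τ (u ++ v) ≡ τ v ++ τ u
τ-++ u v = trans (cong reverse (map-++ swap u v)) (reverse-++ (map swap u) (map swap v))

swap-involutive : (a : Letter) → swap (swap a) ≡ a
swap-involutive p = refl
swap-involutive y = refl

τ-involutive : (w : Word) → τ (τ w) ≡ w
τ-involutive w = begin
  reverse (map swap (reverse (map swap w)))  ≡⟨ cong reverse (reverse-map swap (map swap w)) ⟩
  reverse (reverse (map swap (map swap w)))  ≡⟨ reverse-involutive _ ⟩
  map swap (map swap w)                      ≡⟨ map-∘ w ⟨
  map (swap ∘ swap) w                        ≡⟨ map-cong swap-involutive w ⟩
  map id w                                   ≡⟨ map-id w ⟩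
  w ∎
  where open ≡-Reasoning

τ-replicate : (k : ℕ) (a : Letter) → τ (replicate k a) ≡ replicate k (swap a)
τ-replicate zero a = refl
τ-replicate (suc k) a = begin
  τ (a ∷ replicate k a)                     ≡⟨ τ-++ (a ∷ []) (replicate k a) ⟩
  τ (replicate k a) ++ swap a ∷ []          ≡⟨ cong (_++ swap a ∷ []) (τ-replicate k a) ⟩
  replicate k (swap a) ++ swap a ∷ []       ≡⟨ replicate-suc-++ k (swap a) [] ⟨
  replicate (suc k) (swap a) ++ []          ≡⟨ ++-identityʳ _ ⟩
  replicate (suc k) (swap a) ∎
  where open ≡-Reasoning

fromZ-++ : (z z′ : List ℕ) → fromZ (z ++ z′) ≡ fromZ z ++ fromZ z′
fromZ-++ [] z′ = refl
fromZ-++ (k ∷ z) z′ =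
  trans (cong (λ w → replicate k p ++ y ∷ w) (fromZ-++ z z′)) (sym (++-assoc (replicate k p) _ _))

τ-fromZ-∷ʳ : (z : List ℕ) (k : ℕ) → τ (fromZ (z ∷ʳ k)) ≡ p ∷ y^ k ++ τ (fromZ z)
τ-fromZ-∷ʳ z k = begin
  τ (fromZ (z ++ k ∷ []))
    ≡⟨ cong τ (fromZ-++ z (k ∷ [])) ⟩
  τ (fromZ z ++ replicate k p ++ y ∷ [])
    ≡⟨ τ-++ (fromZ z) _ ⟩
  τ (replicate k p ++ y ∷ []) ++ τ (fromZ z)
    ≡⟨ cong (_++ τ (fromZ z)) (τ-++ (replicate k p) (y ∷ [])) ⟩
  (p ∷ τ (replicate k p)) ++ τ (fromZ z)
    ≡⟨ cong (λ w → p ∷ w ++ τ (fromZ z)) (τ-replicate k p) ⟩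
  p ∷ y^ k ++ τ (fromZ z) ∎
  where open ≡-Reasoning

fromZ-toZ-go : (k : ℕ) (u : Word) → fromZ (toZ-go k (u ++ y ∷ [])) ≡ replicate k p ++ u ++ y ∷ []
fromZ-toZ-go k [] = refl
fromZ-toZ-go k (p ∷ u) = trans (fromZ-toZ-go (suc k) u) (replicate-suc-++ k p _)
fromZ-toZ-go k (y ∷ u) = cong (λ w → replicate k p ++ y ∷ w) (fromZ-toZ-go 0 u)

fromZ-toZ : {w : Word} → InH1 w → fromZ (toZ w) ≡ w
fromZ-toZ (inj₁ refl) = refl
fromZ-toZ (inj₂ (u , refl)) = fromZ-toZ-go 0 u

τ-InHm1 : {w : Word} → InHm1 w → InH1 (τ w)
τ-InHm1 (inj₁ refl) = inj₁ refl
τ-InHm1 (inj₂ (u , refl)) = inj₂ (τ u , τ-++ (p ∷ []) u)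

τ-fromZ-toZ-τ : {w : Word} → InHm1 w → τ (fromZ (toZ (τ w))) ≡ w
τ-fromZ-toZ-τ {w} w∈ = trans (cong τ (fromZ-toZ (τ-InHm1 w∈))) (τ-involutive w)

eval-shW-[]ʳ : (φ : Word → ℚ) (u : Word) → eval φ (shW u []) ≡ φ u
eval-shW-[]ʳ φ [] = eval-unit φ []
eval-shW-[]ʳ φ (a ∷ u) = eval-unit φ (a ∷ u)

eval-shW-y^ˡ : (n : ℕ) (u v : Word) (φ : Word → ℚ) →
  eval φ (shW (y^ n ++ u) v) ≡ eval (φ ∘ (y^ n ++_)) (shW u v)
eval-shW-y^ˡ zero u v φ = refl
eval-shW-y^ˡ (suc n) u [] φ = trans (eval-unit φ _) (sym (eval-shW-[]ʳ (φ ∘ (y^ suc n ++_)) u))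
eval-shW-y^ˡ (suc n) u (a ∷ v) φ =
  trans (eval-linMap φ (y ∷_) (shW (y^ n ++ u) (a ∷ v))) (eval-shW-y^ˡ n u (a ∷ v) (φ ∘ (y ∷_)))

eval-shW-y∷ʳ : (u v : Word) (φ : Word → ℚ) →
  eval φ (shW u (y ∷ v)) ≡ eval (φ ∘ (y ∷_)) (shW u v)
eval-shW-y∷ʳ [] v φ = refl
eval-shW-y∷ʳ (y ∷ u) v φ =
  trans (eval-linMap φ (y ∷_) (shW u (y ∷ v)))
    (trans (eval-shW-y∷ʳ u v (φ ∘ (y ∷_))) (sym (eval-shW-y^ˡ 1 u v (φ ∘ (y ∷_)))))
eval-shW-y∷ʳ (p ∷ u) v φ = eval-linMap φ (y ∷_) (shW (p ∷ u) v)

eval-shW-y^ʳ : (m : ℕ) (u v : Word) (φ : Word → ℚ) →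
  eval φ (shW u (y^ m ++ v)) ≡ eval (φ ∘ (y^ m ++_)) (shW u v)
eval-shW-y^ʳ zero u v φ = refl
eval-shW-y^ʳ (suc m) u v φ =
  trans (eval-shW-y∷ʳ u (y^ m ++ v) φ) (eval-shW-y^ʳ m u v (φ ∘ (y ∷_)))

eval-shW-p-p : (φ : Word → ℚ) (u v : Word) →
  eval φ (shW (p ∷ u) (p ∷ v)) ≡
  eval (φ ∘ (p ∷_)) (shW u (p ∷ v)) ⊕ eval (φ ∘ (p ∷_)) (shW (p ∷ u) v)
    ⊖ eval (φ ∘ (p ∷_)) (shW u v)
eval-shW-p-p φ u v = eval-⊕⊖ φ (p ∷_) (p ∷_) (p ∷_) (shW u (p ∷ v)) (shW (p ∷ u) v) (shW u v)

eval-τ-fromZ-∷ʳ : (φ : Word → ℚ) (k : ℕ) (P : Lin (List ℕ)) →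
  eval (φ ∘ τ ∘ fromZ ∘ (_∷ʳ k)) P ≡ eval (φ ∘ (p ∷_) ∘ (y^ k ++_) ∘ τ ∘ fromZ) P
eval-τ-fromZ-∷ʳ φ k = eval-cong (λ z → cong φ (τ-fromZ-∷ʳ z k))

DualityAt : List ℕ → List ℕ → Set
DualityAt u v =
  (φ : Word → ℚ) → eval (φ ∘ τ ∘ fromZ) (qsh u v) ≡ eval φ (shW (τ (fromZ u)) (τ (fromZ v)))

DualityAt-∷ʳ-∷ʳ : (u v : List ℕ) (n m : ℕ) →
  DualityAt u (v ∷ʳ m) → DualityAt (u ∷ʳ n) v → DualityAt u v → DualityAt (u ∷ʳ n) (v ∷ʳ m)
DualityAt-∷ʳ-∷ʳ u v n m dualˡ dualʳ dual φ = begin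
  eval (φ ∘ τ ∘ fromZ) (qsh (u ∷ʳ n) (v ∷ʳ m))
    ≡⟨ eval-qsh-∷ʳ-∷ʳ u v n m (φ ∘ τ ∘ fromZ) ⟩
  eval (φ ∘ τ ∘ fromZ ∘ (_∷ʳ n)) (qsh u (v ∷ʳ m))
    ⊕ eval (φ ∘ τ ∘ fromZ ∘ (_∷ʳ m)) (qsh (u ∷ʳ n) v)
    ⊖ eval (φ ∘ τ ∘ fromZ ∘ (_∷ʳ (n ℕ.+ m))) (qsh u v)
    ≡⟨ ⊕⊖-cong dropLastˡ dropLastʳ dropLastBoth ⟩
  eval (φ ∘ (p ∷_)) (shW (y^ n ++ U) (p ∷ y^ m ++ V))
    ⊕ eval (φ ∘ (p ∷_)) (shW (p ∷ y^ n ++ U) (y^ m ++ V))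
    ⊖ eval (φ ∘ (p ∷_)) (shW (y^ n ++ U) (y^ m ++ V))
    ≡⟨ eval-shW-p-p φ (y^ n ++ U) (y^ m ++ V) ⟨
  eval φ (shW (p ∷ y^ n ++ U) (p ∷ y^ m ++ V))
    ≡⟨ cong₂ (λ s t → eval φ (shW s t)) (τ-fromZ-∷ʳ u n) (τ-fromZ-∷ʳ v m) ⟨
  eval φ (shW (τ (fromZ (u ∷ʳ n))) (τ (fromZ (v ∷ʳ m)))) ∎
  where
  open ≡-Reasoning
  U V : Word
  U = τ (fromZ u)
  V = τ (fromZ v)

  dropLastˡ : eval (φ ∘ τ ∘ fromZ ∘ (_∷ʳ n)) (qsh u (v ∷ʳ m)) ≡
              eval (φ ∘ (p ∷_)) (shW (y^ n ++ U) (p ∷ y^ m ++ V))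
  dropLastˡ = begin
    eval (φ ∘ τ ∘ fromZ ∘ (_∷ʳ n)) (qsh u (v ∷ʳ m))
      ≡⟨ eval-τ-fromZ-∷ʳ φ n (qsh u (v ∷ʳ m)) ⟩
    eval (φ ∘ (p ∷_) ∘ (y^ n ++_) ∘ τ ∘ fromZ) (qsh u (v ∷ʳ m))
      ≡⟨ dualˡ _ ⟩
    eval (φ ∘ (p ∷_) ∘ (y^ n ++_)) (shW U (τ (fromZ (v ∷ʳ m))))
      ≡⟨ cong (λ t → eval _ (shW U t)) (τ-fromZ-∷ʳ v m) ⟩
    eval (φ ∘ (p ∷_) ∘ (y^ n ++_)) (shW U (p ∷ y^ m ++ V))
      ≡⟨ eval-shW-y^ˡ n U _ _ ⟨
    eval (φ ∘ (p ∷_)) (shW (y^ n ++ U) (p ∷ y^ m ++ V)) ∎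

  dropLastʳ : eval (φ ∘ τ ∘ fromZ ∘ (_∷ʳ m)) (qsh (u ∷ʳ n) v) ≡
              eval (φ ∘ (p ∷_)) (shW (p ∷ y^ n ++ U) (y^ m ++ V))
  dropLastʳ = begin
    eval (φ ∘ τ ∘ fromZ ∘ (_∷ʳ m)) (qsh (u ∷ʳ n) v)
      ≡⟨ eval-τ-fromZ-∷ʳ φ m (qsh (u ∷ʳ n) v) ⟩
    eval (φ ∘ (p ∷_) ∘ (y^ m ++_) ∘ τ ∘ fromZ) (qsh (u ∷ʳ n) v)
      ≡⟨ dualʳ _ ⟩
    eval (φ ∘ (p ∷_) ∘ (y^ m ++_)) (shW (τ (fromZ (u ∷ʳ n))) V)
      ≡⟨ cong (λ s → eval _ (shW s V)) (τ-fromZ-∷ʳ u n) ⟩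
    eval (φ ∘ (p ∷_) ∘ (y^ m ++_)) (shW (p ∷ y^ n ++ U) V)
      ≡⟨ eval-shW-y^ʳ m (p ∷ y^ n ++ U) V (φ ∘ (p ∷_)) ⟨
    eval (φ ∘ (p ∷_)) (shW (p ∷ y^ n ++ U) (y^ m ++ V)) ∎

  dropLastBoth : eval (φ ∘ τ ∘ fromZ ∘ (_∷ʳ (n ℕ.+ m))) (qsh u v) ≡
                 eval (φ ∘ (p ∷_)) (shW (y^ n ++ U) (y^ m ++ V))
  dropLastBoth = begin
    eval (φ ∘ τ ∘ fromZ ∘ (_∷ʳ (n ℕ.+ m))) (qsh u v)
      ≡⟨ eval-τ-fromZ-∷ʳ φ (n ℕ.+ m) (qsh u v) ⟩
    eval (φ ∘ (p ∷_) ∘ (y^ (n ℕ.+ m) ++_) ∘ τ ∘ fromZ) (qsh u v)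
      ≡⟨ dual _ ⟩
    eval (φ ∘ (p ∷_) ∘ (y^ (n ℕ.+ m) ++_)) (shW U V)
      ≡⟨ eval-cong (cong (φ ∘ (p ∷_)) ∘ replicate-+-++ n m y) (shW U V) ⟨
    eval (φ ∘ (p ∷_) ∘ (y^ n ++_) ∘ (y^ m ++_)) (shW U V)
      ≡⟨ eval-shW-y^ʳ m U V _ ⟨
    eval (φ ∘ (p ∷_) ∘ (y^ n ++_)) (shW U (y^ m ++ V))
      ≡⟨ eval-shW-y^ˡ n U _ _ ⟨
    eval (φ ∘ (p ∷_)) (shW (y^ n ++ U) (y^ m ++ V)) ∎

qsh-τ-duality : {u v : List ℕ} → Reverse u → Reverse v → DualityAt u v
qsh-τ-duality [] _ φ = refl
qsh-τ-duality (u ∶ _ ∶ʳ n) [] φ =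
  trans (eval-qsh-[]ʳ (φ ∘ τ ∘ fromZ) (u ∷ʳ n)) (sym (eval-shW-[]ʳ φ _))
qsh-τ-duality (u ∶ ru ∶ʳ n) (v ∶ rv ∶ʳ m) =
  DualityAt-∷ʳ-∷ʳ u v n m
    (qsh-τ-duality ru (v ∶ rv ∶ʳ m)) (qsh-τ-duality (u ∶ ru ∶ʳ n) rv) (qsh-τ-duality ru rv)

τ-qshW-τ≈shW : {u v : Word} → InHm1 u → InHm1 v → (φ : Word → ℚ) →
  eval (φ ∘ τ) (qshW (τ u) (τ v)) ≡ eval φ (shW u v)
τ-qshW-τ≈shW {u} {v} u∈ v∈ φ = begin
  eval (φ ∘ τ) (linMap fromZ (qsh z z′))
    ≡⟨ eval-linMap (φ ∘ τ) fromZ (qsh z z′) ⟩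
  eval (φ ∘ τ ∘ fromZ) (qsh z z′)
    ≡⟨ qsh-τ-duality (reverseView z) (reverseView z′) φ ⟩
  eval φ (shW (τ (fromZ z)) (τ (fromZ z′)))
    ≡⟨ cong₂ (λ s t → eval φ (shW s t)) (τ-fromZ-toZ-τ u∈) (τ-fromZ-toZ-τ v∈) ⟩
  eval φ (shW u v) ∎
  where
  open ≡-Reasoning
  z z′ : List ℕ
  z = toZ (τ u)
  z′ = toZ (τ v)

theorem5p12 : (P Q : Lin Word) → InH0Lin P → InH0Lin Q → boxProd P Q ≈ shProd P Q
theorem5p12 P Q hP hQ = eval≡⇒≈ (boxProd P Q) (shProd P Q) λ φ → begin
  eval φ (τLin (bilin qshW (τLin P) (τLin Q)))
    ≡⟨ eval-linMap φ τ (bilin qshW (τLin P) (τLin Q)) ⟩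
  eval (φ ∘ τ) (bilin qshW (τLin P) (τLin Q))
    ≡⟨ bilin-eval-cong InH0 τ (φ ∘ τ) φ qshW shW P Q hP hQ
         (λ u∈ v∈ → τ-qshW-τ≈shW (proj₂ u∈) (proj₂ v∈) φ) ⟩
  eval φ (bilin shW P Q) ∎
  where open ≡-Reasoning
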